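{- Let $1\leq r\leq n-2$ and let $G\cong K_r\vee (n-r)K_1$. Then $m(-1)=r-1$.
   Context: $K_r$ is the complete graph on $r$ vertices, $(n-r)K_1$ is the edgeless graph on $n-r$ vertices, and $\vee$ denotes the join (disjoint union plus all edges between the two parts). For a connected graph $G$, $d(u,v)$ is the distance and $\varepsilon(v)=\max_u d(u,v)$ the eccentricity. The eccentricity matrix $\mathcal{A}(G)$ is indexed by $V(G)$ with $(u,v)$-entry $d(u,v)$ if $d(u,v)=\min\{\varepsilon(u),\varepsilon(v)\}$ and $0$ otherwise. $m(-1)$ is the multiplicity of $-1$ as an eigenvalue of $\mathcal{A}(G)$. -}

module Defs where

open import Data.Bool using (Bool; true; false; _∧_; _∨_; not; if_then_else_)
open import Data.Nat using (ℕ; zero; suc; _⊔_; _⊓_; _≡ᵇ_; _<ᵇ_; _≤_)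
open import Data.Fin using (Fin; toℕ)
open import Data.List using (List; foldr; map; allFin)
open import Data.Bool.ListAction using (any)
open import Data.Integer using (+_)
open import Data.Rational using (ℚ; 0ℚ; _+_; _*_; _/_)
open import Data.Product using (Σ; _×_)
open import Relation.Binary.PropositionalEquality using (_≡_)

Graph : ℕ → Set
Graph n = Fin n → Fin n → Bool

finEq : ∀ {n} → Fin n → Fin n → Bool
finEq u v = toℕ u ≡ᵇ toℕ v

reach : ∀ {n} → Graph n → ℕ → Fin n → Fin n → Bool
reach G zero u v = finEq u v
reach {n} G (suc k) u v =
  reach G k u v ∨ any (λ w → reach G k u w ∧ G w v) (allFin n)

distSearch : ∀ {n} → Graph n → Fin n → Fin n → ℕ → ℕ → ℕ
distSearch G u v zero k = k
distSearch G u v (suc f) k = if reach G k u v then k else distSearch G u v f (suc k)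

-- Distance d(u,v) (correct for connected graphs, where d(u,v) ≤ n - 1).
dist : ∀ {n} → Graph n → Fin n → Fin n → ℕ
dist {n} G u v = distSearch G u v n 0

ecc : ∀ {n} → Graph n → Fin n → ℕ
ecc {n} G u = foldr _⊔_ 0 (map (dist G u) (allFin n))

Connected : ∀ {n} → Graph n → Set
Connected {n} G = ∀ u v → reach G n u v ≡ true

eccMatrixℕ : ∀ {n} → Graph n → Fin n → Fin n → ℕ
eccMatrixℕ G u v =
  if dist G u v ≡ᵇ (ecc G u ⊓ ecc G v) then dist G u v else 0

ℕtoℚ : ℕ → ℚ
ℕtoℚ m = + m / 1

Matrix : ℕ → Set
Matrix n = Fin n → Fin n → ℚ

eccMatrix : ∀ {n} → Graph n → Matrix n
eccMatrix G u v = ℕtoℚ (eccMatrixℕ G u v)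

-- The complete split graph K_r ∨ (n-r)K_1: vertices with index < r form the clique,
-- the rest are independent, every clique vertex is joined to every other vertex.
completeSplit : (n r : ℕ) → Graph n
completeSplit n r u v = not (finEq u v) ∧ ((toℕ u <ᵇ r) ∨ (toℕ v <ᵇ r))

Σℚ : ∀ {k} → (Fin k → ℚ) → ℚ
Σℚ {k} f = foldr _+_ 0ℚ (map f (allFin k))

mulVec : ∀ {n} → Matrix n → (Fin n → ℚ) → Fin n → ℚ
mulVec M x i = Σℚ (λ j → M i j * x j)

IsEigenvector : ∀ {n} → Matrix n → ℚ → (Fin n → ℚ) → Set
IsEigenvector M λ₀ x = ∀ i → mulVec M x i ≡ λ₀ * x i

LinIndep : ∀ {n k} → (Fin k → Fin n → ℚ) → Set
LinIndep {n} {k} vs =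
  (c : Fin k → ℚ) → (∀ i → Σℚ (λ j → c j * vs j i) ≡ 0ℚ) → ∀ j → c j ≡ 0ℚ

-- Multiplicity m of the eigenvalue λ₀ of M: the dimension of the eigenspace,
-- i.e. m linearly independent eigenvectors exist, and no larger independent family does.
-- (For the real symmetric eccentricity matrix this equals the algebraic multiplicity.)
EigMultiplicity : ∀ {n} → Matrix n → ℚ → ℕ → Set
EigMultiplicity {n} M λ₀ m =
  Σ (Fin m → Fin n → ℚ) (λ vs → LinIndep vs × (∀ j → IsEigenvector M λ₀ (vs j)))
  × (∀ k (vs : Fin k → Fin n → ℚ) → LinIndep vs → (∀ j → IsEigenvector M λ₀ (vs j)) → k ≤ m)

{-# OPTIONS --safe #-}

-- For 1 ≤ r and at least two independent vertices, every clique vertex has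
-- eccentricity 1 and every independent vertex eccentricity 2, so the eccentricity
-- matrix A coincides with the distance matrix. Reading off its rows, Ax = -x says
-- Σx = 0 (at a clique vertex) and x_u = Σx + Σ_I x (at an independent vertex u,
-- Σ_I summing over the independent set I). Hence all independent coordinates equal
-- Σ_I x, and summing them gives Σ_I x = |I| Σ_I x with |I| ≥ 2, so they vanish.
-- The (-1)-eigenspace is therefore {x supported on the clique with Σx = 0}: it
-- contains the r - 1 independent vectors e_{v_i} - e_{v_0}, and restricting to
-- v_1, …, v_{r-1} is injective on it, so by the Steinitz bound (k independent
-- vectors in ℚᵐ force k ≤ m, by Gaussian elimination) no larger family exists.

module Submission where

open import Algebra.Bundles using (CommutativeRing)
open import Data.Bool using (Bool; true; false; not; _∧_; _∨_; if_then_else_)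
open import Data.Bool.ListAction using (any)
open import Data.Bool.Properties
  using (T-≡; ∨-zeroʳ; ∨-identityʳ; ∨-conicalˡ; ∨-conicalʳ; ∧-zeroʳ; ¬-not; if-eta)
open import Data.Fin using (Fin; zero; suc; toℕ; fromℕ<; inject≤; punchIn; punchOut)
open import Data.Fin.Properties
  using (_≟_; toℕ-injective; suc-injective; toℕ<n; toℕ-fromℕ<; toℕ-inject≤; inject≤-injective;
         punchInᵢ≢i; punchIn-punchOut; all?; ¬∀⟶∃¬)
open import Data.List using (List; foldr; map; tabulate; allFin)
open import Data.List.Membership.Propositional using (_∈_; lose)
open import Data.List.Membership.Propositional.Properties using (∈-map⁺; ∈-allFin)
open import Data.List.Properties using (foldr-preservesᵇ)
open import Data.List.Relation.Unary.All.Properties using (map⁺; tabulate⁺)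
open import Data.List.Relation.Unary.Any using (here; there; satisfied)
open import Data.List.Relation.Unary.Any.Properties using (any⁺; any⁻)
open import Data.Nat using (ℕ; zero; suc; _≤_; _<_; _∸_; _⊔_; _⊓_; _≡ᵇ_; _<ᵇ_; z≤n; s≤s)
import Data.Nat.Properties as ℕ
open import Data.Product using (_,_; _×_; proj₁; proj₂; ∃-syntax)
open import Data.Rational using (ℚ; 0ℚ; 1ℚ; -_; _-_; _*_; 1/_; ≢-nonZero)
import Data.Rational as ℚ
import Data.Rational.Properties as ℚ
open import Data.Rational.Properties using (+-*-commutativeRing)
open import Data.Rational.Solver using (module +-*-Solver)
open import Data.Vec.Functional using (insertAt; removeAt)
open import Data.Vec.Functional.Properties using (insertAt-lookup; insertAt-punchIn)
open import Function.Base using (_∘_)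
open import Function.Bundles using (Equivalence; _↔_; Inverse)
open import Relation.Binary.PropositionalEquality
open import Relation.Nullary using (¬_; Dec; yes; no; contradiction)
open import Relation.Nullary.Decidable using (dec-true; dec-false; from-yes; from-no)

open import Defs

open CommutativeRing +-*-commutativeRing using (semiring)
open import Algebra.Properties.Semiring.Sum semiring
  using (sum; sum-cong-≗; sum-replicate-zero; sum-remove; ∑-distrib-+; ∑-comm; *-distribˡ-sum; *-distribʳ-sum)
open +-*-Solver

private
  variable
    k m n : ℕ

≡ᵇ-refl : (m : ℕ) → (m ≡ᵇ m) ≡ true
≡ᵇ-refl m = dec-true (m ℕ.≟ m) refl

<ᵇ-true : ∀ {m n} → m < n → (m <ᵇ n) ≡ true
<ᵇ-true m<n = Equivalence.to T-≡ (ℕ.<⇒<ᵇ m<n)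

<ᵇ-false : ∀ {m n} → ¬ m < n → (m <ᵇ n) ≡ false
<ᵇ-false {m} {n} m≮n = ¬-not (m≮n ∘ ℕ.<ᵇ⇒< m n ∘ Equivalence.from T-≡)

finEq-refl : (u : Fin n) → finEq u u ≡ true
finEq-refl u = dec-true (toℕ u ℕ.≟ toℕ u) refl

finEq-≢ : {u v : Fin n} → u ≢ v → finEq u v ≡ false
finEq-≢ {u = u} {v} u≢v = dec-false (toℕ u ℕ.≟ toℕ v) (u≢v ∘ toℕ-injective)

finEq-injective : (f : Fin m → Fin n) → (∀ {x y} → f x ≡ f y → x ≡ y) →
                  ∀ u v → finEq (f u) (f v) ≡ finEq u v
finEq-injective f f-injective u v with u ≟ v
... | yes refl = trans (finEq-refl (f u)) (sym (finEq-refl u))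
... | no  u≢v  = trans (finEq-≢ (u≢v ∘ f-injective)) (sym (finEq-≢ u≢v))

any-allFin-intro : (f : Fin n → Bool) (w : Fin n) → f w ≡ true → any f (allFin n) ≡ true
any-allFin-intro f w fw≡true =
  Equivalence.to T-≡ (any⁺ f (lose (∈-allFin w) (Equivalence.from T-≡ fw≡true)))

any-allFin-elim : (f : Fin n → Bool) → any f (allFin n) ≡ true → ∃[ w ] f w ≡ true
any-allFin-elim {n} f any≡true with w , Tfw ← satisfied (any⁻ f (allFin n) (Equivalence.from T-≡ any≡true)) =
  w , Equivalence.to T-≡ Tfw

any-allFin-false : (f : Fin n → Bool) → (∀ w → f w ≡ false) → any f (allFin n) ≡ false
any-allFin-false f f≡false = ¬-not λ any≡true →
  let w , fw≡true = any-allFin-elim f any≡true in contradiction (trans (sym fw≡true) (f≡false w)) λ ()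

module _ (G : Graph n) where

  reach-step : ∀ {k u w v} → reach G k u w ≡ true → G w v ≡ true → reach G (suc k) u v ≡ true
  reach-step {k} {u} {w} {v} uw vw =
    trans (cong (reach G k u v ∨_) (any-allFin-intro _ w (cong₂ _∧_ uw vw))) (∨-zeroʳ _)

  reach-edge : ∀ {u v} → G u v ≡ true → reach G 1 u v ≡ true
  reach-edge {u} = reach-step {0} {u} (finEq-refl u)

  reach-1-non-edge : ∀ {u v} → u ≢ v → G u v ≡ false → reach G 1 u v ≡ false
  reach-1-non-edge {u} {v} u≢v Guv≡false =
    cong₂ _∨_ (finEq-≢ u≢v) (any-allFin-false _ no-path)
    where
    no-path : ∀ w → finEq u w ∧ G w v ≡ false
    no-path w with u ≟ w
    ... | yes refl = trans (cong (finEq u u ∧_) Guv≡false) (∧-zeroʳ _)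
    ... | no u≢w = cong (_∧ G w v) (finEq-≢ u≢w)

module _ (G : Graph n) (u v : Fin n) where

  distSearch-found : ∀ fuel k → reach G k u v ≡ true → distSearch G u v (suc fuel) k ≡ k
  distSearch-found fuel k found = cong (if_then k else distSearch G u v fuel (suc k)) found

  distSearch-skip : ∀ fuel k → reach G k u v ≡ false →
                    distSearch G u v (suc fuel) k ≡ distSearch G u v fuel (suc k)
  distSearch-skip fuel k missed = cong (if_then k else distSearch G u v fuel (suc k)) missed

dist-refl : (G : Graph (suc n)) (u : Fin (suc n)) → dist G u u ≡ 0
dist-refl {n} G u = distSearch-found G u u n 0 (finEq-refl u)

dist-edge : (G : Graph (suc (suc n))) {u v : Fin (suc (suc n))} →
            u ≢ v → G u v ≡ true → dist G u v ≡ 1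
dist-edge {n} G {u} {v} u≢v uv = trans (distSearch-skip G u v (suc n) 0 (finEq-≢ u≢v))
                               (distSearch-found G u v n 1 (reach-edge G uv))

-- dist searches only up to the number of vertices, so distance 2 needs at least three.
dist-two-step : (G : Graph (suc (suc (suc n)))) {u w v : Fin (suc (suc (suc n)))} →
                u ≢ v → G u v ≡ false → G u w ≡ true → G w v ≡ true → dist G u v ≡ 2
dist-two-step {n} G {u} {w} {v} u≢v ¬uv uw wv =
  trans (distSearch-skip G u v (suc (suc n)) 0 (finEq-≢ u≢v)) (
  trans (distSearch-skip G u v (suc n) 1 (reach-1-non-edge G u≢v ¬uv))
        (distSearch-found G u v n 2 (reach-step G {1} {u} {w} (reach-edge G uw) wv)))

∈⇒≤foldr-⊔ : ∀ {m} {xs : List ℕ} → m ∈ xs → m ≤ foldr _⊔_ 0 xs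
∈⇒≤foldr-⊔ (here refl)  = ℕ.m≤m⊔n _ _
∈⇒≤foldr-⊔ (there m∈xs) = ℕ.≤-trans (∈⇒≤foldr-⊔ m∈xs) (ℕ.m≤n⊔m _ _)

ecc≡ : (G : Graph n) (u w : Fin n) {e : ℕ} → (∀ v → dist G u v ≤ e) → dist G u w ≡ e → ecc G u ≡ e
ecc≡ G u w {e} bound reached = ℕ.≤-antisym
  (foldr-preservesᵇ {P = _≤ e} ℕ.⊔-lub z≤n (map⁺ (tabulate⁺ bound)))
  (subst (_≤ ecc G u) reached (∈⇒≤foldr-⊔ (∈-map⁺ (dist G u) (∈-allFin w))))

eccMatrixℕ≡dist : (G : Graph (suc n)) (u v : Fin (suc n)) →
                  (u ≢ v → dist G u v ≡ ecc G u ⊓ ecc G v) → eccMatrixℕ G u v ≡ dist G u v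
eccMatrixℕ≡dist G u v dist≡ecc⊓ecc with u ≟ v
... | no u≢v = cong (if_then dist G u v else 0)
  (trans (cong (dist G u v ≡ᵇ_) (sym (dist≡ecc⊓ecc u≢v))) (≡ᵇ-refl (dist G u v)))
... | yes refl = trans (cong (λ d → if d ≡ᵇ ecc G u ⊓ ecc G u then d else 0) (dist-refl G u))
                       (trans (if-eta _) (sym (dist-refl G u)))

-- ℚ's _+_ is opened only locally: the statement of lemma3p6 uses ℕ's.
module _ where
  open import Data.Rational using (_+_)

  2ℚ : ℚ
  2ℚ = 1ℚ + 1ℚ

  foldr-map-tabulate : (f : Fin n → ℚ) (g : Fin k → Fin n) →
                       foldr _+_ 0ℚ (map f (tabulate g)) ≡ sum (λ i → f (g i))
  foldr-map-tabulate {k = zero} f g = refl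
  foldr-map-tabulate {k = suc k} f g = cong (f (g zero) +_) (foldr-map-tabulate f (λ i → g (suc i)))

  Σℚ≡sum : (f : Fin n → ℚ) → Σℚ f ≡ sum f
  Σℚ≡sum f = foldr-map-tabulate f (λ i → i)

  sum-zero : {f : Fin n → ℚ} → (∀ i → f i ≡ 0ℚ) → sum f ≡ 0ℚ
  sum-zero {n} f≡0 = trans (sum-cong-≗ f≡0) (sum-replicate-zero n)

  sum-single : (f : Fin n → ℚ) (i : Fin n) → (∀ j → j ≢ i → f j ≡ 0ℚ) → sum f ≡ f i
  sum-single {suc n} f i f≡0 = begin
    sum f                              ≡⟨ sum-remove f ⟩
    f i + sum (λ j → f (punchIn i j))  ≡⟨ cong (f i +_) (sum-zero λ j → f≡0 (punchIn i j) (punchInᵢ≢i i j)) ⟩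
    f i + 0ℚ                           ≡⟨ ℚ.+-identityʳ (f i) ⟩
    f i                                ∎
    where open ≡-Reasoning

  sum-neg : (f : Fin n → ℚ) → sum (λ i → - f i) ≡ - sum f
  sum-neg f = begin
    sum (λ i → - f i)       ≡⟨ sum-cong-≗ (λ i → -x≡-1*x (f i)) ⟩
    sum (λ i → - 1ℚ * f i)  ≡⟨ *-distribˡ-sum (- 1ℚ) f ⟨
    - 1ℚ * sum f            ≡⟨ -x≡-1*x (sum f) ⟨
    - sum f                 ∎
    where
    open ≡-Reasoning
    -x≡-1*x : ∀ x → - x ≡ - 1ℚ * x
    -x≡-1*x = solve 1 (λ x → :- x := (:- con 1ℚ) :* x) refl

  ∑-distrib-sub : (f g : Fin n → ℚ) → sum (λ i → f i - g i) ≡ sum f - sum g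
  ∑-distrib-sub f g = trans (∑-distrib-+ f (λ i → - g i)) (cong (sum f +_) (sum-neg g))

  sum-insertAt : (c : Fin k → ℚ) (p : Fin (suc k)) (x : ℚ) (v : Fin (suc k) → ℚ) →
                 sum (λ j → insertAt c p x j * v j) ≡ x * v p + sum (λ j → c j * v (punchIn p j))
  sum-insertAt c p x v = trans (sum-remove {i = p} (λ j → insertAt c p x j * v j)) (cong₂ _+_
    (cong (_* v p) (insertAt-lookup c p x))
    (sum-cong-≗ (λ j → cong (_* v (punchIn p j)) (insertAt-punchIn c p x j))))

  linIndep-tail : (vs : Fin k → Fin (suc n) → ℚ) → (∀ j → vs j zero ≡ 0ℚ) →
                  LinIndep vs → LinIndep (λ j i → vs j (suc i))
  linIndep-tail vs vs₀≡0 li c comb≡0 = li c λ where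
    zero    → trans (Σℚ≡sum (λ j → c j * vs j zero))
                    (sum-zero λ j → trans (cong (c j *_) (vs₀≡0 j)) (ℚ.*-zeroʳ (c j)))
    (suc i) → comb≡0 i

  -- One step of Gaussian elimination: with q the inverse of the pivot entry vs p zero,
  -- clear the first coordinate of the other vectors and drop it.
  eliminate : (vs : Fin (suc k) → Fin (suc n) → ℚ) (p : Fin (suc k)) (q : ℚ) → Fin k → Fin n → ℚ
  eliminate vs p q j i = vs (punchIn p j) (suc i) - (vs (punchIn p j) zero * q) * vs p (suc i)

  -- A dependency c among the eliminated vectors lifts to one among vs, the pivot
  -- vector getting the coefficient that cancels the first coordinate.
  linIndep-eliminate : (vs : Fin (suc k) → Fin (suc n) → ℚ) (p : Fin (suc k)) (q : ℚ) →
                       q * vs p zero ≡ 1ℚ → LinIndep vs → LinIndep (eliminate vs p q)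
  linIndep-eliminate vs p q q*pivot≡1 li c comb≡0 j = begin
    c j                           ≡⟨ insertAt-punchIn c p x j ⟨
    insertAt c p x (punchIn p j)  ≡⟨ li (insertAt c p x) lifted≡0 (punchIn p j) ⟩
    0ℚ                            ∎
    where
    open ≡-Reasoning
    U : Fin _ → ℚ
    U j = vs (punchIn p j) zero
    T = sum (λ j → c j * U j)
    x = - (T * q)
    lifted : ∀ i → sum (λ j → insertAt c p x j * vs j i) ≡ 0ℚ
    lifted zero = begin
      sum (λ j → insertAt c p x j * vs j zero)
        ≡⟨ sum-insertAt c p x (λ j → vs j zero) ⟩
      x * vs p zero + T
        ≡⟨ solve 3 (λ t q a → (:- (t :* q)) :* a :+ t := t :- t :* (q :* a)) refl T q (vs p zero) ⟩
      T - T * (q * vs p zero)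
        ≡⟨ cong (λ y → T - T * y) q*pivot≡1 ⟩
      T - T * 1ℚ
        ≡⟨ solve 1 (λ t → t :- t :* con 1ℚ := con 0ℚ) refl T ⟩
      0ℚ ∎
    lifted (suc i) = begin
      sum (λ j → insertAt c p x j * vs j (suc i))
        ≡⟨ sum-insertAt c p x (λ j → vs j (suc i)) ⟩
      x * X + sum (λ j → c j * V j)
        ≡⟨ solve 4 (λ t q x s → (:- (t :* q)) :* x :+ s := s :- t :* (q :* x)) refl T q X _ ⟩
      sum (λ j → c j * V j) - T * (q * X)
        ≡⟨ cong (λ y → sum (λ j → c j * V j) - y) (*-distribʳ-sum (q * X) (λ j → c j * U j)) ⟩
      sum (λ j → c j * V j) - sum (λ j → c j * U j * (q * X))
        ≡⟨ ∑-distrib-sub (λ j → c j * V j) (λ j → c j * U j * (q * X)) ⟨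
      sum (λ j → c j * V j - c j * U j * (q * X))
        ≡⟨ sum-cong-≗ (λ j → solve 5 (λ c v u q x → c :* v :- c :* u :* (q :* x) := c :* (v :- u :* q :* x))
                                     refl (c j) (V j) (U j) q X) ⟩
      sum (λ j → c j * eliminate vs p q j i)
        ≡⟨ Σℚ≡sum (λ j → c j * eliminate vs p q j i) ⟨
      Σℚ (λ j → c j * eliminate vs p q j i)
        ≡⟨ comb≡0 i ⟩
      0ℚ ∎
      where
      X = vs p (suc i)
      V : Fin _ → ℚ
      V j = vs (punchIn p j) (suc i)
    lifted≡0 : ∀ i → Σℚ (λ j → insertAt c p x j * vs j i) ≡ 0ℚ
    lifted≡0 i = trans (Σℚ≡sum (λ j → insertAt c p x j * vs j i)) (lifted i)

  linIndep⇒≤ : (vs : Fin k → Fin n → ℚ) → LinIndep vs → k ≤ n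
  linIndep⇒≤ {zero} vs li = z≤n
  linIndep⇒≤ {suc k} {zero} vs li with () ← li (λ _ → 1ℚ) (λ ()) zero
  linIndep⇒≤ {suc k} {suc n} vs li with all? (λ j → vs j zero ℚ.≟ 0ℚ)
  ... | yes vs₀≡0 = ℕ.m≤n⇒m≤1+n (linIndep⇒≤ _ (linIndep-tail vs vs₀≡0 li))
  ... | no ¬vs₀≡0 with (p , a≢0) ← ¬∀⟶∃¬ _ _ (λ j → vs j zero ℚ.≟ 0ℚ) ¬vs₀≡0 =
    s≤s (linIndep⇒≤ _ (linIndep-eliminate vs p (1/_ (vs p zero) {{nz}}) (ℚ.*-inverseˡ (vs p zero) {{nz}}) li))
    where nz = ≢-nonZero a≢0

  δ : Fin n → Fin n → ℚ
  δ u v = if finEq u v then 1ℚ else 0ℚ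

  δ-diag : (u : Fin n) → δ u u ≡ 1ℚ
  δ-diag u = cong (if_then 1ℚ else 0ℚ) (finEq-refl u)

  δ-off : {u v : Fin n} → u ≢ v → δ u v ≡ 0ℚ
  δ-off u≢v = cong (if_then 1ℚ else 0ℚ) (finEq-≢ u≢v)

  δ-injective : (f : Fin m → Fin n) → (∀ {x y} → f x ≡ f y → x ≡ y) → ∀ u v → δ (f u) (f v) ≡ δ u v
  δ-injective f f-injective u v = cong (if_then 1ℚ else 0ℚ) (finEq-injective f f-injective u v)

  sum-δ : (u : Fin n) (x : Fin n → ℚ) → sum (λ v → x v * δ u v) ≡ x u
  sum-δ u x = begin
    sum (λ v → x v * δ u v)  ≡⟨ sum-single (λ v → x v * δ u v) u off-diagonal ⟩
    x u * δ u u              ≡⟨ cong (x u *_) (δ-diag u) ⟩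
    x u * 1ℚ                 ≡⟨ ℚ.*-identityʳ (x u) ⟩
    x u                      ∎
    where
    open ≡-Reasoning
    off-diagonal : ∀ v → v ≢ u → x v * δ u v ≡ 0ℚ
    off-diagonal v v≢u = trans (cong (x v *_) (δ-off (v≢u ∘ sym))) (ℚ.*-zeroʳ (x v))

  mulVec-row : (M : Matrix n) (x : Fin n → ℚ) (u : Fin n) (w : Fin n → ℚ) (d : ℚ) →
               (∀ v → M u v ≡ w v - d * δ u v) → mulVec M x u ≡ sum (λ v → w v * x v) - d * x u
  mulVec-row M x u w d row = begin
    mulVec M x u                                       ≡⟨ Σℚ≡sum (λ v → M u v * x v) ⟩
    sum (λ v → M u v * x v)                            ≡⟨ sum-cong-≗ expand ⟩
    sum (λ v → w v * x v - d * (x v * δ u v))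
      ≡⟨ ∑-distrib-sub (λ v → w v * x v) (λ v → d * (x v * δ u v)) ⟩
    sum (λ v → w v * x v) - sum (λ v → d * (x v * δ u v))
      ≡⟨ cong (λ y → sum (λ v → w v * x v) - y) (*-distribˡ-sum d (λ v → x v * δ u v)) ⟨
    sum (λ v → w v * x v) - d * sum (λ v → x v * δ u v)
      ≡⟨ cong (λ y → sum (λ v → w v * x v) - d * y) (sum-δ u x) ⟩
    sum (λ v → w v * x v) - d * x u                    ∎
    where
    open ≡-Reasoning
    expand : ∀ v → M u v * x v ≡ w v * x v - d * (x v * δ u v)
    expand v = trans (cong (_* x v) (row v))
      (solve 4 (λ w d e y → (w :- d :* e) :* y := w :* y :- d :* (y :* e)) refl (w v) d (δ u v) (x v))

  sum-nonneg : (f : Fin n → ℚ) → (∀ i → 0ℚ ℚ.≤ f i) → 0ℚ ℚ.≤ sum f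
  sum-nonneg {zero}  f f≥0 = ℚ.≤-refl
  sum-nonneg {suc n} f f≥0 = ℚ.+-mono-≤ (f≥0 zero) (sum-nonneg (f ∘ suc) (f≥0 ∘ suc))

  pair≤sum : (f : Fin n → ℚ) → (∀ i → 0ℚ ℚ.≤ f i) → {a b : Fin n} → a ≢ b → f a + f b ℚ.≤ sum f
  pair≤sum {suc zero} f f≥0 {zero} {zero} a≢b = contradiction refl a≢b
  pair≤sum {suc (suc n)} f f≥0 {a} {b} a≢b = begin
    f a + f b                            ≡⟨ cong (λ v → f a + f v) (punchIn-punchOut a≢b) ⟨
    f a + f (punchIn a b′)               ≡⟨ cong (f a +_) (ℚ.+-identityʳ _) ⟨
    f a + (f (punchIn a b′) + 0ℚ)        ≤⟨ ℚ.+-monoʳ-≤ (f a) (ℚ.+-monoʳ-≤ (f (punchIn a b′)) rest≥0) ⟩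
    f a + (f (punchIn a b′) + sum rest)  ≡⟨ cong (f a +_) (sum-remove {i = b′} (removeAt f a)) ⟨
    f a + sum (removeAt f a)             ≡⟨ sum-remove {i = a} f ⟨
    sum f                                ∎
    where
    open ℚ.≤-Reasoning
    b′ = punchOut a≢b
    rest = removeAt (removeAt f a) b′
    rest≥0 = sum-nonneg rest (f≥0 ∘ punchIn a ∘ punchIn b′)

  x≡t*x⇒x≡0 : ∀ {t x} → 2ℚ ℚ.≤ t → x ≡ t * x → x ≡ 0ℚ
  x≡t*x⇒x≡0 {t} {x} 2≤t x≡tx = begin
    x                                ≡⟨ ℚ.*-identityˡ x ⟨
    1ℚ * x                           ≡⟨ cong (_* x) (ℚ.*-inverseˡ (t - 1ℚ)) ⟨
    1/ (t - 1ℚ) * (t - 1ℚ) * x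
      ≡⟨ solve 3 (λ e t x → e :* (t :- con 1ℚ) :* x := e :* (t :* x :- x)) refl (1/ (t - 1ℚ)) t x ⟩
    1/ (t - 1ℚ) * (t * x - x)        ≡⟨ cong (λ y → 1/ (t - 1ℚ) * (y - x)) x≡tx ⟨
    1/ (t - 1ℚ) * (x - x)            ≡⟨ solve 2 (λ e x → e :* (x :- x) := con 0ℚ) refl (1/ (t - 1ℚ)) x ⟩
    0ℚ                               ∎
    where
    open ≡-Reasoning
    t≢1 : t ≢ 1ℚ
    t≢1 refl = from-no (2ℚ ℚ.≤? 1ℚ) 2≤t
    t-1≢0 : t - 1ℚ ≢ 0ℚ
    t-1≢0 t-1≡0 = t≢1 (begin
      t                ≡⟨ solve 1 (λ t → t := (t :- con 1ℚ) :+ con 1ℚ) refl t ⟩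
      (t - 1ℚ) + 1ℚ    ≡⟨ cong (_+ 1ℚ) t-1≡0 ⟩
      1ℚ               ∎)
    instance
      _ = ≢-nonZero t-1≢0

oneOrTwo : Bool → ℕ
oneOrTwo b = if b then 1 else 2

oneOrTwo-∨ : ∀ b c → oneOrTwo (b ∨ c) ≡ oneOrTwo b ⊓ oneOrTwo c
oneOrTwo-∨ true  true  = refl
oneOrTwo-∨ true  false = refl
oneOrTwo-∨ false true  = refl
oneOrTwo-∨ false false = refl

-- The paper's K_{r+1} ∨ (n+2-r) K₁: the clique has r + 1 vertices, enumerated by
-- vertex, and a, b are two of the independent vertices.
module CompleteSplit
  {n r : ℕ} (G : Graph (suc (suc (suc n)))) (clique : Fin (suc (suc (suc n))) → Bool)
  (G-split : ∀ u v → G u v ≡ not (finEq u v) ∧ (clique u ∨ clique v))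
  (vertex : Fin (suc r) → Fin (suc (suc (suc n))))
  (vertex-injective : ∀ {i j} → vertex i ≡ vertex j → i ≡ j)
  (clique-vertex : ∀ i → clique (vertex i) ≡ true)
  (clique⇒vertex : ∀ v → clique v ≡ true → ∃[ i ] v ≡ vertex i)
  {a b : Fin (suc (suc (suc n)))} (a∉K : clique a ≡ false) (b∉K : clique b ≡ false) (a≢b : a ≢ b)
  where

  open import Data.Rational using (_+_)

  -- Where a goal mentions A or indep, case splits are passed in as arguments rather
  -- than made by `with`, which normalises the goal (unfolding A exhausts memory).
  by-clique : ∀ {p} {P : Set p} v → (clique v ≡ true → P) → (clique v ≡ false → P) → P
  by-clique {P = P} v on-clique off-clique = decide (clique v) refl
    where
    decide : ∀ k → clique v ≡ k → P
    decide true  = on-clique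
    decide false = off-clique

  clique-≢ : ∀ {u v} → clique u ≡ true → clique v ≡ false → u ≢ v
  clique-≢ u∈K v∉K refl = contradiction (trans (sym u∈K) v∉K) λ ()

  edge : ∀ {u v} → u ≢ v → clique u ∨ clique v ≡ true → G u v ≡ true
  edge {u} {v} u≢v uv = trans (G-split u v) (cong₂ (λ e k → not e ∧ k) (finEq-≢ u≢v) uv)

  non-edge : ∀ {u v} → clique u ∨ clique v ≡ false → G u v ≡ false
  non-edge {u} {v} uv = trans (G-split u v) (trans (cong (not (finEq u v) ∧_) uv) (∧-zeroʳ _))

  dist-split : ∀ {u v} → u ≢ v → dist G u v ≡ oneOrTwo (clique u ∨ clique v)
  dist-split {u} {v} u≢v with clique u ∨ clique v in uv
  ... | true  = dist-edge G u≢v (edge u≢v uv)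
  ... | false = dist-two-step G u≢v (non-edge uv)
    (edge (clique-≢ c∈K u∉K ∘ sym) (trans (cong (clique u ∨_) c∈K) (∨-zeroʳ _)))
    (edge (clique-≢ c∈K v∉K) (cong (_∨ clique v) c∈K))
    where
    c∈K = clique-vertex zero
    u∉K = ∨-conicalˡ _ _ uv
    v∉K = ∨-conicalʳ _ _ uv

  farthest : Fin (suc (suc (suc n))) → Fin (suc (suc (suc n)))
  farthest u with u ≟ a
  ... | yes _ = b
  ... | no  _ = a

  farthest-≢ : ∀ u → u ≢ farthest u
  farthest-≢ u with u ≟ a
  ... | yes refl = a≢b
  ... | no  u≢a  = u≢a

  farthest∉K : ∀ u → clique (farthest u) ≡ false
  farthest∉K u with u ≟ a
  ... | yes _ = b∉K
  ... | no  _ = a∉K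

  dist-bound : ∀ u v → dist G u v ≤ oneOrTwo (clique u)
  dist-bound u v with u ≟ v
  ... | yes refl = ℕ.≤-trans (ℕ.≤-reflexive (dist-refl G u)) z≤n
  ... | no  u≢v  = ℕ.≤-trans (ℕ.≤-reflexive (trans (dist-split u≢v) (oneOrTwo-∨ (clique u) (clique v))))
                             (ℕ.m⊓n≤m _ _)

  ecc-split : ∀ u → ecc G u ≡ oneOrTwo (clique u)
  ecc-split u = ecc≡ G u (farthest u) (dist-bound u)
    (trans (dist-split (farthest-≢ u)) (cong oneOrTwo (trans (cong (clique u ∨_) (farthest∉K u)) (∨-identityʳ _))))

  dist≡ecc⊓ecc : ∀ {u v} → u ≢ v → dist G u v ≡ ecc G u ⊓ ecc G v
  dist≡ecc⊓ecc {u} {v} u≢v = begin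
    dist G u v                                    ≡⟨ dist-split u≢v ⟩
    oneOrTwo (clique u ∨ clique v)                ≡⟨ oneOrTwo-∨ (clique u) (clique v) ⟩
    oneOrTwo (clique u) ⊓ oneOrTwo (clique v)     ≡⟨ cong₂ _⊓_ (ecc-split u) (ecc-split v) ⟨
    ecc G u ⊓ ecc G v                             ∎
    where open ≡-Reasoning

  A : Matrix (suc (suc (suc n)))
  A = eccMatrix G

  indep : Fin (suc (suc (suc n))) → ℚ
  indep v = if clique v then 0ℚ else 1ℚ

  indep-∈ : ∀ {v} → clique v ≡ true → indep v ≡ 0ℚ
  indep-∈ = cong (if_then 0ℚ else 1ℚ)

  indep-∉ : ∀ {v} → clique v ≡ false → indep v ≡ 1ℚ
  indep-∉ = cong (if_then 0ℚ else 1ℚ)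

  A≡dist : ∀ u v → A u v ≡ ℕtoℚ (dist G u v)
  A≡dist u v = cong ℕtoℚ (eccMatrixℕ≡dist G u v dist≡ecc⊓ecc)

  A-clique-row : ∀ {u v} → clique u ≡ true → Dec (u ≡ v) → A u v ≡ 1ℚ - 1ℚ * δ u v
  A-clique-row {u} u∈K (yes refl) = begin
    A u u                                   ≡⟨ A≡dist u u ⟩
    ℕtoℚ (dist G u u)                       ≡⟨ cong ℕtoℚ (dist-refl G u) ⟩
    1ℚ - 1ℚ * 1ℚ                            ≡⟨ cong (λ e → 1ℚ - 1ℚ * e) (δ-diag u) ⟨
    1ℚ - 1ℚ * δ u u                         ∎
    where open ≡-Reasoning
  A-clique-row {u} {v} u∈K (no u≢v) = begin
    A u v                                   ≡⟨ A≡dist u v ⟩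
    ℕtoℚ (dist G u v)                       ≡⟨ cong ℕtoℚ (dist-split u≢v) ⟩
    ℕtoℚ (oneOrTwo (clique u ∨ clique v))   ≡⟨ cong (λ k → ℕtoℚ (oneOrTwo (k ∨ clique v))) u∈K ⟩
    1ℚ - 1ℚ * 0ℚ                            ≡⟨ cong (λ e → 1ℚ - 1ℚ * e) (δ-off u≢v) ⟨
    1ℚ - 1ℚ * δ u v                         ∎
    where open ≡-Reasoning

  A-indep-row : ∀ {u v} → clique u ≡ false → Dec (u ≡ v) → A u v ≡ (1ℚ + indep v) - 2ℚ * δ u v
  A-indep-row {u} u∉K (yes refl) = begin
    A u u                                   ≡⟨ A≡dist u u ⟩
    ℕtoℚ (dist G u u)                       ≡⟨ cong ℕtoℚ (dist-refl G u) ⟩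
    (1ℚ + 1ℚ) - 2ℚ * 1ℚ
      ≡⟨ cong₂ (λ i e → (1ℚ + i) - 2ℚ * e) (indep-∉ u∉K) (δ-diag u) ⟨
    (1ℚ + indep u) - 2ℚ * δ u u             ∎
    where open ≡-Reasoning
  A-indep-row {u} {v} u∉K (no u≢v) = begin
    A u v                                   ≡⟨ A≡dist u v ⟩
    ℕtoℚ (dist G u v)                       ≡⟨ cong ℕtoℚ (dist-split u≢v) ⟩
    ℕtoℚ (oneOrTwo (clique u ∨ clique v))   ≡⟨ cong (λ k → ℕtoℚ (oneOrTwo (k ∨ clique v))) u∉K ⟩
    ℕtoℚ (oneOrTwo (clique v))              ≡⟨ off-diagonal (clique v) ⟩
    (1ℚ + indep v) - 2ℚ * 0ℚ                ≡⟨ cong (λ e → (1ℚ + indep v) - 2ℚ * e) (δ-off u≢v) ⟨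
    (1ℚ + indep v) - 2ℚ * δ u v             ∎
    where
    open ≡-Reasoning
    off-diagonal : ∀ k → ℕtoℚ (oneOrTwo k) ≡ (1ℚ + (if k then 0ℚ else 1ℚ)) - 2ℚ * 0ℚ
    off-diagonal true  = refl
    off-diagonal false = refl

  sumᴵ : (Fin (suc (suc (suc n))) → ℚ) → ℚ
  sumᴵ x = sum (λ v → indep v * x v)

  mulVec-clique-row : ∀ x {u} → clique u ≡ true → mulVec A x u ≡ sum x - x u
  mulVec-clique-row x {u} u∈K =
    trans (mulVec-row A x u (λ _ → 1ℚ) 1ℚ (λ v → A-clique-row u∈K (u ≟ v)))
          (cong₂ _-_ (sum-cong-≗ (λ v → ℚ.*-identityˡ (x v))) (ℚ.*-identityˡ (x u)))

  mulVec-indep-row : ∀ x {u} → clique u ≡ false → mulVec A x u ≡ (sum x + sumᴵ x) - 2ℚ * x u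
  mulVec-indep-row x {u} u∉K =
    trans (mulVec-row A x u (λ v → 1ℚ + indep v) 2ℚ (λ v → A-indep-row u∉K (u ≟ v)))
          (cong (_- 2ℚ * x u) (trans (sum-cong-≗ expand) (∑-distrib-+ x (λ v → indep v * x v))))
    where
    expand : ∀ v → (1ℚ + indep v) * x v ≡ x v + indep v * x v
    expand v = solve 2 (λ i y → (con 1ℚ :+ i) :* y := y :+ i :* y) refl (indep v) (x v)

  2≤sum-indep : 2ℚ ℚ.≤ sum indep
  2≤sum-indep = subst (ℚ._≤ sum indep) (cong₂ _+_ (indep-∉ a∉K) (indep-∉ b∉K))
                      (pair≤sum indep indep≥0 a≢b)
    where
    indep≥0 : ∀ v → 0ℚ ℚ.≤ indep v
    indep≥0 v = by-clique v (λ v∈K → ℚ.≤-reflexive (sym (indep-∈ v∈K)))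
                            (λ v∉K → subst (0ℚ ℚ.≤_) (sym (indep-∉ v∉K)) (from-yes (0ℚ ℚ.≤? 1ℚ)))

  ZeroSumOnClique : (Fin (suc (suc (suc n))) → ℚ) → Set
  ZeroSumOnClique x = (∀ v → clique v ≡ false → x v ≡ 0ℚ) × sum x ≡ 0ℚ

  eigenvector⇒zeroSumOnClique : ∀ x → IsEigenvector A (- 1ℚ) x → ZeroSumOnClique x
  eigenvector⇒zeroSumOnClique x eig = (λ v v∉K → trans (x≡sumᴵ v v∉K) sumᴵ≡0) , sum≡0
    where
    open ≡-Reasoning
    sum≡0 : sum x ≡ 0ℚ
    sum≡0 = begin
      sum x
        ≡⟨ solve 2 (λ s y → s := (s :- y) :+ y) refl (sum x) (x (vertex zero)) ⟩
      (sum x - x (vertex zero)) + x (vertex zero)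
        ≡⟨ cong (_+ x (vertex zero)) (trans (sym (mulVec-clique-row x (clique-vertex zero))) (eig (vertex zero))) ⟩
      - 1ℚ * x (vertex zero) + x (vertex zero)
        ≡⟨ solve 1 (λ y → (:- con 1ℚ) :* y :+ y := con 0ℚ) refl (x (vertex zero)) ⟩
      0ℚ ∎
    x≡sumᴵ : ∀ v → clique v ≡ false → x v ≡ sumᴵ x
    x≡sumᴵ v v∉K = begin
      x v
        ≡⟨ solve 3 (λ s w y → y := (s :+ w) :- ((s :+ w) :- con 2ℚ :* y) :+ (:- con 1ℚ) :* y)
                   refl (sum x) (sumᴵ x) (x v) ⟩
      (sum x + sumᴵ x) - ((sum x + sumᴵ x) - 2ℚ * x v) + - 1ℚ * x v
        ≡⟨ cong (λ z → (sum x + sumᴵ x) - z + - 1ℚ * x v) (trans (sym (mulVec-indep-row x v∉K)) (eig v)) ⟩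
      (sum x + sumᴵ x) - - 1ℚ * x v + - 1ℚ * x v
        ≡⟨ solve 3 (λ s w y → (s :+ w) :- y :+ y := s :+ w) refl (sum x) (sumᴵ x) (- 1ℚ * x v) ⟩
      sum x + sumᴵ x
        ≡⟨ cong (_+ sumᴵ x) sum≡0 ⟩
      0ℚ + sumᴵ x
        ≡⟨ ℚ.+-identityˡ (sumᴵ x) ⟩
      sumᴵ x ∎
    sumᴵ≡t*sumᴵ : sumᴵ x ≡ sum indep * sumᴵ x
    sumᴵ≡t*sumᴵ = begin
      sum (λ v → indep v * x v)       ≡⟨ sum-cong-≗ pointwise ⟩
      sum (λ v → indep v * sumᴵ x)    ≡⟨ *-distribʳ-sum (sumᴵ x) indep ⟨
      sum indep * sumᴵ x              ∎
      where
      pointwise : ∀ v → indep v * x v ≡ indep v * sumᴵ x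
      pointwise v = by-clique v
        (λ v∈K → trans (cong (_* x v) (indep-∈ v∈K))
                   (trans (ℚ.*-zeroˡ (x v)) (sym (trans (cong (_* sumᴵ x) (indep-∈ v∈K)) (ℚ.*-zeroˡ (sumᴵ x))))))
        (λ v∉K → cong (indep v *_) (x≡sumᴵ v v∉K))
    sumᴵ≡0 : sumᴵ x ≡ 0ℚ
    sumᴵ≡0 = x≡t*x⇒x≡0 2≤sum-indep sumᴵ≡t*sumᴵ

  zeroSumOnClique⇒eigenvector : ∀ x → ZeroSumOnClique x → IsEigenvector A (- 1ℚ) x
  zeroSumOnClique⇒eigenvector x (x∉K≡0 , sum≡0) u = row (clique u) refl
    where
    open ≡-Reasoning
    sumᴵ≡0 : sumᴵ x ≡ 0ℚ
    sumᴵ≡0 = sum-zero pointwise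
      where
      pointwise : ∀ v → indep v * x v ≡ 0ℚ
      pointwise v = by-clique v
        (λ v∈K → trans (cong (_* x v) (indep-∈ v∈K)) (ℚ.*-zeroˡ (x v)))
        (λ v∉K → trans (cong (indep v *_) (x∉K≡0 v v∉K)) (ℚ.*-zeroʳ (indep v)))
    row : ∀ k → clique u ≡ k → mulVec A x u ≡ - 1ℚ * x u
    row true u∈K = begin
      mulVec A x u                   ≡⟨ mulVec-clique-row x u∈K ⟩
      sum x - x u                    ≡⟨ cong (_- x u) sum≡0 ⟩
      0ℚ - x u                       ≡⟨ solve 1 (λ y → con 0ℚ :- y := (:- con 1ℚ) :* y) refl (x u) ⟩
      - 1ℚ * x u                     ∎
    row false u∉K = begin
      mulVec A x u                   ≡⟨ mulVec-indep-row x u∉K ⟩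
      (sum x + sumᴵ x) - 2ℚ * x u    ≡⟨ cong₂ (λ s w → (s + w) - 2ℚ * x u) sum≡0 sumᴵ≡0 ⟩
      (0ℚ + 0ℚ) - 2ℚ * x u           ≡⟨ cong (λ y → (0ℚ + 0ℚ) - 2ℚ * y) (x∉K≡0 u u∉K) ⟩
      (0ℚ + 0ℚ) - 2ℚ * 0ℚ            ≡⟨ cong (- 1ℚ *_) (x∉K≡0 u u∉K) ⟨
      - 1ℚ * x u                     ∎

  basis : Fin r → Fin (suc (suc (suc n))) → ℚ
  basis i v = δ (vertex (suc i)) v - δ (vertex zero) v

  basis-zeroSumOnClique : ∀ i → ZeroSumOnClique (basis i)
  basis-zeroSumOnClique i = basis∉K≡0 , sum-basis≡0
    where
    open ≡-Reasoning
    sum-δ-row : ∀ u → sum (δ u) ≡ 1ℚ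
    sum-δ-row u = trans (sum-cong-≗ (λ v → sym (ℚ.*-identityˡ (δ u v)))) (sum-δ u (λ _ → 1ℚ))
    basis∉K≡0 : ∀ v → clique v ≡ false → basis i v ≡ 0ℚ
    basis∉K≡0 v v∉K = cong₂ _-_ (δ-off (clique-≢ (clique-vertex (suc i)) v∉K))
                                (δ-off (clique-≢ (clique-vertex zero) v∉K))
    sum-basis≡0 : sum (basis i) ≡ 0ℚ
    sum-basis≡0 = begin
      sum (basis i)
        ≡⟨ ∑-distrib-sub (δ (vertex (suc i))) (δ (vertex zero)) ⟩
      sum (δ (vertex (suc i))) - sum (δ (vertex zero))
        ≡⟨ cong₂ _-_ (sum-δ-row (vertex (suc i))) (sum-δ-row (vertex zero)) ⟩
      1ℚ - 1ℚ
        ≡⟨⟩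
      0ℚ ∎

  basis-linIndep : LinIndep basis
  basis-linIndep c comb≡0 i = begin
    c i                                          ≡⟨ ℚ.*-identityʳ (c i) ⟨
    c i * 1ℚ                                     ≡⟨ cong (c i *_) (trans (basis-at i i) (δ-diag i)) ⟨
    c i * basis i (vertex (suc i))               ≡⟨ sum-single (λ j → c j * basis j (vertex (suc i))) i off-diagonal ⟨
    sum (λ j → c j * basis j (vertex (suc i)))   ≡⟨ Σℚ≡sum (λ j → c j * basis j (vertex (suc i))) ⟨
    Σℚ (λ j → c j * basis j (vertex (suc i)))    ≡⟨ comb≡0 (vertex (suc i)) ⟩
    0ℚ                                           ∎
    where
    open ≡-Reasoning
    basis-at : ∀ j i → basis j (vertex (suc i)) ≡ δ j i
    basis-at j i = begin
      δ (vertex (suc j)) (vertex (suc i)) - δ (vertex zero) (vertex (suc i))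
        ≡⟨ cong₂ _-_ (δ-injective (vertex ∘ suc) (suc-injective ∘ vertex-injective) j i)
                     (δ-off ((λ ()) ∘ vertex-injective)) ⟩
      δ j i - 0ℚ
        ≡⟨ solve 1 (λ d → d :- con 0ℚ := d) refl (δ j i) ⟩
      δ j i ∎
    off-diagonal : ∀ j → j ≢ i → c j * basis j (vertex (suc i)) ≡ 0ℚ
    off-diagonal j j≢i = trans (cong (c j *_) (trans (basis-at j i) (δ-off j≢i))) (ℚ.*-zeroʳ (c j))

  zeroSumOnClique-lincomb : ∀ {k} (vs : Fin k → Fin (suc (suc (suc n))) → ℚ) → (∀ j → ZeroSumOnClique (vs j)) →
                            (c : Fin k → ℚ) → ZeroSumOnClique (λ v → sum (λ j → c j * vs j v))
  zeroSumOnClique-lincomb vs vs-zs c = combination∉K≡0 , sum-combination≡0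
    where
    open ≡-Reasoning
    sum-combination≡0 : sum (λ v → sum (λ j → c j * vs j v)) ≡ 0ℚ
    sum-combination≡0 = begin
      sum (λ v → sum (λ j → c j * vs j v))   ≡⟨ ∑-comm (λ j v → c j * vs j v) ⟨
      sum (λ j → sum (λ v → c j * vs j v))   ≡⟨ sum-zero (λ j → trans (sym (*-distribˡ-sum (c j) (vs j)))
                                                           (trans (cong (c j *_) (proj₂ (vs-zs j))) (ℚ.*-zeroʳ (c j)))) ⟩
      0ℚ                                     ∎
    combination∉K≡0 : ∀ v → clique v ≡ false → sum (λ j → c j * vs j v) ≡ 0ℚ
    combination∉K≡0 v v∉K = sum-zero (λ j → trans (cong (c j *_) (proj₁ (vs-zs j) v v∉K)) (ℚ.*-zeroʳ (c j)))

  zeroSumOnClique-determined : ∀ y → ZeroSumOnClique y → (∀ i → y (vertex (suc i)) ≡ 0ℚ) →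
                               ∀ v → y v ≡ 0ℚ
  zeroSumOnClique-determined y (y∉K≡0 , sum≡0) y-rest≡0 = y≡0
    where
    y-off-apex : ∀ w → w ≢ vertex zero → y w ≡ 0ℚ
    y-off-apex w w≢apex with clique w in w∈?
    ... | false = y∉K≡0 w w∈?
    ... | true with clique⇒vertex w w∈?
    ...   | zero  , refl = contradiction refl w≢apex
    ...   | suc i , refl = y-rest≡0 i
    y≡0 : ∀ v → y v ≡ 0ℚ
    y≡0 v with v ≟ vertex zero
    ... | yes refl = trans (sym (sum-single y (vertex zero) y-off-apex)) sum≡0
    ... | no v≢apex = y-off-apex v v≢apex

  linIndep-restrict : ∀ {k} (vs : Fin k → Fin (suc (suc (suc n))) → ℚ) → (∀ j → ZeroSumOnClique (vs j)) →
                      LinIndep vs → LinIndep (λ j i → vs j (vertex (suc i)))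
  linIndep-restrict vs vs-zs li c comb≡0 = li c λ v →
    trans (Σℚ≡sum (λ j → c j * vs j v))
          (zeroSumOnClique-determined (λ v → sum (λ j → c j * vs j v)) (zeroSumOnClique-lincomb vs vs-zs c)
            (λ i → trans (sym (Σℚ≡sum (λ j → c j * vs j (vertex (suc i))))) (comb≡0 i)) v)

  multiplicity : EigMultiplicity A (- 1ℚ) r
  multiplicity =
    (basis , basis-linIndep , λ i → zeroSumOnClique⇒eigenvector (basis i) (basis-zeroSumOnClique i)) ,
    λ k vs li eig → linIndep⇒≤ _ (linIndep-restrict vs (λ j → eigenvector⇒zeroSumOnClique (vs j) (eig j)) li)

module Relabelled
  {n r : ℕ} (r≤n : r ≤ n) (G : Graph (suc (suc (suc n))))
  (σ : Fin (suc (suc (suc n))) ↔ Fin (suc (suc (suc n))))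
  (G≅split : ∀ u v → G (Inverse.to σ u) (Inverse.to σ v) ≡ completeSplit (suc (suc (suc n))) (suc r) u v)
  where

  open Inverse σ using (to; from; strictlyInverseˡ; strictlyInverseʳ)

  to-injective : ∀ {u v} → to u ≡ to v → u ≡ v
  to-injective {u} {v} e = trans (sym (strictlyInverseʳ u)) (trans (cong from e) (strictlyInverseʳ v))

  from-injective : ∀ {u v} → from u ≡ from v → u ≡ v
  from-injective {u} {v} e = trans (sym (strictlyInverseˡ u)) (trans (cong to e) (strictlyInverseˡ v))

  clique : Fin (suc (suc (suc n))) → Bool
  clique v = toℕ (from v) <ᵇ suc r

  G-split : ∀ u v → G u v ≡ not (finEq u v) ∧ (clique u ∨ clique v)
  G-split u v = begin
    G u v
      ≡⟨ cong₂ G (strictlyInverseˡ u) (strictlyInverseˡ v) ⟨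
    G (to (from u)) (to (from v))
      ≡⟨ G≅split (from u) (from v) ⟩
    not (finEq (from u) (from v)) ∧ (clique u ∨ clique v)
      ≡⟨ cong (λ e → not e ∧ (clique u ∨ clique v)) (finEq-injective from from-injective u v) ⟩
    not (finEq u v) ∧ (clique u ∨ clique v) ∎
    where open ≡-Reasoning

  clique-to : ∀ i → clique (to i) ≡ (toℕ i <ᵇ suc r)
  clique-to i = cong (λ w → toℕ w <ᵇ suc r) (strictlyInverseʳ i)

  1+r≤N : suc r ≤ suc (suc (suc n))
  1+r≤N = s≤s (ℕ.m≤n⇒m≤1+n (ℕ.m≤n⇒m≤1+n r≤n))

  vertex : Fin (suc r) → Fin (suc (suc (suc n)))
  vertex i = to (inject≤ i 1+r≤N)

  vertex-injective : ∀ {i j} → vertex i ≡ vertex j → i ≡ j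
  vertex-injective = inject≤-injective 1+r≤N 1+r≤N _ _ ∘ to-injective

  clique-vertex : ∀ i → clique (vertex i) ≡ true
  clique-vertex i = trans (clique-to (inject≤ i 1+r≤N))
                          (trans (cong (_<ᵇ suc r) (toℕ-inject≤ i 1+r≤N)) (<ᵇ-true (toℕ<n i)))

  clique⇒vertex : ∀ v → clique v ≡ true → ∃[ i ] v ≡ vertex i
  clique⇒vertex v v∈K = fromℕ< label<1+r , trans (sym (strictlyInverseˡ v)) (cong to from-v≡)
    where
    label<1+r = ℕ.<ᵇ⇒< _ _ (Equivalence.from T-≡ v∈K)
    from-v≡ : from v ≡ inject≤ (fromℕ< label<1+r) 1+r≤N
    from-v≡ = toℕ-injective (sym (trans (toℕ-inject≤ (fromℕ< label<1+r) 1+r≤N) (toℕ-fromℕ< label<1+r)))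

  label>r⇒∉clique : ∀ {k} (k<N : k < suc (suc (suc n))) → r < k → clique (to (fromℕ< k<N)) ≡ false
  label>r⇒∉clique k<N r<k = trans (clique-to (fromℕ< k<N))
    (trans (cong (_<ᵇ suc r) (toℕ-fromℕ< k<N)) (<ᵇ-false (ℕ.<⇒≱ r<k ∘ ℕ.≤-pred)))

  a<N : suc r < suc (suc (suc n))
  a<N = s≤s (s≤s (ℕ.m≤n⇒m≤1+n r≤n))

  b<N : suc (suc r) < suc (suc (suc n))
  b<N = s≤s (s≤s (s≤s r≤n))

  a≢b : to (fromℕ< a<N) ≢ to (fromℕ< b<N)
  a≢b e = ℕ.1+n≢n (trans (sym (toℕ-fromℕ< b<N)) (trans (cong toℕ (to-injective (sym e))) (toℕ-fromℕ< a<N)))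

  open CompleteSplit G clique G-split vertex vertex-injective clique-vertex clique⇒vertex
    (label>r⇒∉clique a<N (ℕ.n<1+n r)) (label>r⇒∉clique b<N (ℕ.m<n⇒m<1+n (ℕ.n<1+n r))) a≢b
    public using (multiplicity)

completeSplit-multiplicity : ∀ {n r} → suc (suc (suc r)) ≤ n → (G : Graph n) (σ : Fin n ↔ Fin n) →
  (∀ u v → G (Inverse.to σ u) (Inverse.to σ v) ≡ completeSplit n (suc r) u v) →
  EigMultiplicity (eccMatrix G) (- 1ℚ) r
completeSplit-multiplicity (s≤s (s≤s (s≤s r≤n))) = Relabelled.multiplicity r≤n

open import Data.Nat using (_+_)

lemma3p6 : (n r : ℕ) → 1 ≤ r → r + 2 ≤ n → (G : Graph n) → (σ : Fin n ↔ Fin n)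
    → (∀ u v → G (Inverse.to σ u) (Inverse.to σ v) ≡ completeSplit n r u v)
    → EigMultiplicity (eccMatrix G) (- 1ℚ) (r ∸ 1)
lemma3p6 n (suc r) (s≤s z≤n) r+2≤n = completeSplit-multiplicity (subst (_≤ n) (ℕ.+-comm (suc r) 2) r+2≤n)
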